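{- For every ISRL $IS$ with model $M$, every formula $\varphi$ of the $A\bar BN$ fragment of EHS$^+$, and all intervals $I,I'$ of $M$ with $MCT^\varphi_I=MCT^\varphi_{I'}$, we have $M,I\models\varphi$ if and only if $M,I'\models\varphi$.
   Context: Regular expressions over a finite set $X$: $e::=\emptyset\mid\epsilon\mid s\mid e;e\mid e+e\mid e^*$ ($s\in X$), with the usual language $\mathcal L(e)$; $RE_X$ denotes the set of these expressions. An ISRL over agents $A=\{0,\dots,m\}$ is a tuple $IS=(\{L_i\},\{l^0_i\},\{ACT_i\},\{P_i\},\{t_i\},\lambda)$ where $L_i$ is a finite set of local states, $l^0_i\in L_i$, $ACT_i$ a finite set of actions, $P_i:L_i\to2^{ACT_i}$, $t_i\subseteq L_i\times ACT\times L_i$ with $ACT=ACT_0\times\dots\times ACT_m$, and $\lambda:\mathit{Var}\to RE_G$ where $G=L_0\times\dots\times L_m$ and $\mathit{Var}$ is a finite set of propositional variables. $t^G(g,g')$ holds iff some joint action $(a_0,\dots,a_m)$ satisfies, for all $i$, $a_i\in P_i(l_i)$ and $t_i(l_i,(a_0,\dots,a_m),l'_i)$ where $l_i,l'_i$ are the $i$-th components of $g,g'$. The model $M$ of $IS$: states $S$ are nonempty sequences $g_0\dots g_k$ with $g_0=(l^0_0,\dots,l^0_m)$ and $t^G(g_j,g_{j+1})$; $t(g_0\dots g_k,g'_0\dots g'_l)$ iff $l=k+1$ and $g_j=g'_j$ for $j\le k$; $g_0\dots g_k\sim_i g'_0\dots g'_l$ iff $g_k,g'_l$ have equal $i$-th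 components; $\mathrm g(g_0\dots g_k)=g_k$. An interval is a finite nonempty sequence $I=s_1\dots s_n$ of states with $t(s_j,s_{j+1})$; $\mathrm g(I)=\mathrm g(s_1)\cdots\mathrm g(s_n)$; $first(I)=s_1$, $last(I)=s_n$; $pi(I)$ is true iff $n=1$. $IR_AI'$ iff $first(I')=last(I)$; $IR_{\bar B}I'$ iff $I'=II_1$ for some interval $I_1$; $IR_NI'$ iff $t(last(I),first(I'))$. $I\sim_iI'$ iff they have equal length and are pointwise $\sim_i$-related; $\sim_\Gamma=(\bigcup_{i\in\Gamma}\sim_i)^*$. Put $R_{\langle A\rangle}=R_A$, $R_{\langle\bar B\rangle}=R_{\bar B}$, $R_{\langle N\rangle}=R_N$, $R_{K_i}=\sim_i$, $R_{C_\Gamma}=\sim_\Gamma$. Formulas: $\varphi::=pi\mid p\mid\neg\varphi\mid\varphi\wedge\varphi\mid K_i\varphi\mid C_\Gamma\varphi\mid\langle A\rangle\varphi\mid\langle\bar B\rangle\varphi\mid\langle N\rangle\varphi$. Semantics: $I\models pi$ iff $pi(I)$; $I\models p$ iff $\mathrm g(I)\in\mathcal L(\lambda(p))$; Booleans as usual; for each modality $X$, $I\models X\varphi$ iff for all (for $K_i$, $C_\Gamma$) resp. for some (for $\langle A\rangle,\langle\bar B\rangle,\langle N\rangle$) interval $I'$ with $IR_XI'$, $I'\models\varphi$. A top-level sub-formula of $\varphi$ is a sub-formula of the form $X\varphi'$ with $X$ one of the modalities above, not in the scope of any modality. For $p\in\mathit{Var}$ let $\mathcal A^p$ be the minimal deterministic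 finite automaton over alphabet $G$ recognising $\mathcal L(\lambda(p))$, and for an interval $I$ let $\mathcal A_I$ map each $p$ to the state reached by $\mathcal A^p$ after reading $\mathrm g(I)$. The modal context tree $MCT^\varphi_I$ is the minimal unranked tree with labelled nodes and edges such that: its root is labelled $(\mathrm g(first(I)),\mathrm g(last(I)),pi(I),\mathcal A_I)$, and for each top-level sub-formula $X\psi$ of $\varphi$ and each interval $I'$ with $IR_XI'$, the root has an $X\psi$-labelled edge to a child subtree $MCT^\psi_{I'}$ (trees are compared up to isomorphism, identical sibling subtrees with the same edge label being identified). -}

module Defs where

open import Data.Nat using (ℕ; zero; suc; _≡ᵇ_)
open import Data.Fin using (Fin)
open import Data.Fin.Subset using (Subset)
import Data.Fin.Subset as Sub
open import Data.Bool using (Bool; true; false)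
open import Data.List using (List; []; _∷_; _++_; map; [_])
open import Data.List.NonEmpty as L⁺ using (List⁺; _∷_; toList; _⁺∷ʳ_)
open import Data.Product using (Σ; ∃; ∃-syntax; _×_; _,_; proj₁; proj₂)
open import Data.Unit using (⊤)
open import Relation.Nullary using (¬_)
open import Relation.Binary.PropositionalEquality using (_≡_)
open import Relation.Binary.Construct.Closure.ReflexiveTransitive using (Star)
open import Data.List.Relation.Binary.Pointwise using (Pointwise)
open import Function.Bundles using (_⇔_)

data RE (X : Set) : Set where
  ∅ᵣ εᵣ : RE X
  symᵣ : X → RE X
  _⨾_ _⊕_ : RE X → RE X → RE X
  _⋆ : RE X → RE X

data _∈ℒ_ {X : Set} : List X → RE X → Set where
  ε∈   : [] ∈ℒ εᵣ
  sym∈ : ∀ s → [ s ] ∈ℒ symᵣ s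
  ⨾∈   : ∀ {e f u v} → u ∈ℒ e → v ∈ℒ f → (u ++ v) ∈ℒ (e ⨾ f)
  ⊕∈ˡ  : ∀ {e f w} → w ∈ℒ e → w ∈ℒ (e ⊕ f)
  ⊕∈ʳ  : ∀ {e f w} → w ∈ℒ f → w ∈ℒ (e ⊕ f)
  ⋆∈[] : ∀ {e} → [] ∈ℒ (e ⋆)
  ⋆∈∷  : ∀ {e u v} → u ∈ℒ e → v ∈ℒ (e ⋆) → (u ++ v) ∈ℒ (e ⋆)

record ISRL : Set where
  field
    m   : ℕ                                   -- agents A = Fin (suc m) = {0,…,m}
    nL  : Fin (suc m) → ℕ                     -- L_i = Fin (nL i)
    l⁰  : (i : Fin (suc m)) → Fin (nL i)
    nA  : Fin (suc m) → ℕ                     -- ACT_i = Fin (nA i)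
    P   : (i : Fin (suc m)) → Fin (nL i) → Subset (nA i)
    t   : (i : Fin (suc m)) → Fin (nL i) → ((j : Fin (suc m)) → Fin (nA j))
            → Fin (nL i) → Bool               -- t_i ⊆ L_i × ACT × L_i (characteristic fn)
    nV  : ℕ                                   -- Var = Fin nV
    lab : Fin nV → RE ((i : Fin (suc m)) → Fin (nL i))

data Formula (m nV : ℕ) : Set where
  pi    : Formula m nV
  var   : Fin nV → Formula m nV
  ¬ᶠ_   : Formula m nV → Formula m nV
  _∧ᶠ_  : Formula m nV → Formula m nV → Formula m nV
  K     : Fin (suc m) → Formula m nV → Formula m nV
  C     : Subset (suc m) → Formula m nV → Formula m nV
  ⟨A⟩ ⟨B̄⟩ ⟨N⟩ : Formula m nV → Formula m nV

module Model (IS : ISRL) where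
  open ISRL IS

  Agent : Set
  Agent = Fin (suc m)

  G : Set
  G = (i : Agent) → Fin (nL i)

  ACT : Set
  ACT = (i : Agent) → Fin (nA i)

  g⁰ : G
  g⁰ = l⁰

  tG : G → G → Set
  tG g g' = ∃[ a ] (∀ i → (a i Sub.∈ P i (g i)) × (t i (g i) a (g' i) ≡ true))

  Path : G → List G → Set
  Path g [] = ⊤
  Path g (g' ∷ r) = tG g g' × Path g' r

  IsState : List⁺ G → Set
  IsState (g ∷ r) = (g ≡ g⁰) × Path g r

  record State : Set where
    field
      seq   : List⁺ G
      valid : IsState seq
  open State public

  gOf : State → G
  gOf s = L⁺.last (seq s)

  _⟶_ : State → State → Set
  s ⟶ s' = ∃[ g ] (seq s' ≡ seq s ⁺∷ʳ g)

  _∼[_]_ : State → Agent → State → Set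
  s ∼[ i ] s' = gOf s i ≡ gOf s' i

  Chain : State → List State → Set
  Chain s [] = ⊤
  Chain s (s' ∷ r) = (s ⟶ s') × Chain s' r

  IsInterval : List⁺ State → Set
  IsInterval (s ∷ r) = Chain s r

  record Interval : Set where
    field
      states : List⁺ State
      chain  : IsInterval states
  open Interval public

  first lastI : Interval → State
  first I = L⁺.head (states I)
  lastI I = L⁺.last (states I)

  gw : Interval → List G
  gw I = map gOf (toList (states I))

  pi? : Interval → Bool
  pi? I = L⁺.length (states I) ≡ᵇ 1

  -- underlying sequence of state-sequences (states compared by their sequences)
  ⌊_⌋ : Interval → List (List⁺ G)
  ⌊ I ⌋ = map seq (toList (states I))

  R-A R-B̄ R-N : Interval → Interval → Set
  R-A I J = seq (first J) ≡ seq (lastI I)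
  R-B̄ I J = ∃[ I₁ ] (⌊ J ⌋ ≡ ⌊ I ⌋ ++ ⌊ I₁ ⌋)
  R-N I J = lastI I ⟶ first J

  _≈[_]_ : Interval → Agent → Interval → Set
  I ≈[ i ] J = Pointwise (λ s s' → s ∼[ i ] s') (toList (states I)) (toList (states J))

  _≈C[_]_ : Interval → Subset (suc m) → Interval → Set
  I ≈C[ Γ ] J = Star (λ I′ J′ → ∃[ i ] ((i Sub.∈ Γ) × (I′ ≈[ i ] J′))) I J

  Fml : Set
  Fml = Formula m nV

  _⊨_ : Interval → Fml → Set
  I ⊨ pi = pi? I ≡ true
  I ⊨ var p = gw I ∈ℒ lab p
  I ⊨ (¬ᶠ φ) = ¬ (I ⊨ φ)
  I ⊨ (φ ∧ᶠ ψ) = (I ⊨ φ) × (I ⊨ ψ)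
  I ⊨ K i φ = ∀ J → I ≈[ i ] J → J ⊨ φ
  I ⊨ C Γ φ = ∀ J → I ≈C[ Γ ] J → J ⊨ φ
  I ⊨ ⟨A⟩ φ = ∃[ J ] (R-A I J × (J ⊨ φ))
  I ⊨ ⟨B̄⟩ φ = ∃[ J ] (R-B̄ I J × (J ⊨ φ))
  I ⊨ ⟨N⟩ φ = ∃[ J ] (R-N I J × (J ⊨ φ))

  -- Two words reach the same state of the minimal DFA for 𝓛(e)
  -- iff they are Myhill–Nerode equivalent w.r.t. 𝓛(e)
  -- (the states of the minimal DFA are the Nerode classes).
  SameMinDFAState : RE G → List G → List G → Set
  SameMinDFAState e w w' = ∀ u → ((w ++ u) ∈ℒ e) ⇔ ((w' ++ u) ∈ℒ e)

  RootEq : Interval → Interval → Set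
  RootEq I J = (gOf (first I) ≡ gOf (first J))
             × (gOf (lastI I) ≡ gOf (lastI J))
             × (pi? I ≡ pi? J)
             × (∀ p → SameMinDFAState (lab p) (gw I) (gw J))

  -- equality of the sets of children reached via edges labelled by a
  -- given modal formula (children sets equal up to isomorphism)
  BackForth : (Interval → Interval → Set) → (Interval → Interval → Set)
            → Interval → Interval → Set
  BackForth R E I J =
      (∀ I′ → R I I′ → ∃[ J′ ] (R J J′ × E I′ J′))
    × (∀ J′ → R J J′ → ∃[ I′ ] (R I I′ × E I′ J′))

  mutual
    MCTEq : Fml → Interval → Interval → Set
    MCTEq φ I J = RootEq I J × ChildrenEq φ I J

    ChildrenEq : Fml → Interval → Interval → Set
    ChildrenEq pi I J = ⊤
    ChildrenEq (var p) I J = ⊤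
    ChildrenEq (¬ᶠ φ) I J = ChildrenEq φ I J
    ChildrenEq (φ ∧ᶠ ψ) I J = ChildrenEq φ I J × ChildrenEq ψ I J
    ChildrenEq (K i ψ) I J = BackForth (λ X Y → X ≈[ i ] Y) (MCTEq ψ) I J
    ChildrenEq (C Γ ψ) I J = BackForth (λ X Y → X ≈C[ Γ ] Y) (MCTEq ψ) I J
    ChildrenEq (⟨A⟩ ψ) I J = BackForth R-A (MCTEq ψ) I J
    ChildrenEq (⟨B̄⟩ ψ) I J = BackForth R-B̄ (MCTEq ψ) I J
    ChildrenEq (⟨N⟩ ψ) I J = BackForth R-N (MCTEq ψ) I J

{-# OPTIONS --safe #-}
module Submission where

-- Everything the semantics of φ inspects at I is recorded in MCT^φ_I: the root
-- label decides pi and the atoms (an atom holds iff the word g(I) is accepted,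
-- i.e. the Nerode class of g(I) contains the empty suffix), and the edges of a
-- modality form a back-and-forth system between the children of the two
-- roots, along which the claim follows by induction on φ.

open import Defs
open import Data.Bool using (true)
open import Data.List using ([])
open import Data.List.Properties using (++-identityʳ)
open import Data.Product using (_,_; ∃-syntax; _×_)
open import Data.Product.Function.NonDependent.Propositional using (_×-⇔_)
open import Function.Bundles using (_⇔_; mk⇔; Equivalence)
open import Function.Related.TypeIsomorphisms using (¬-cong-⇔)
open import Relation.Binary.PropositionalEquality using (_≡_; subst; subst₂)
import Function.Properties.Equivalence as ⇔

open Equivalence using (to; from)

module _ (IS : ISRL) where
  open Model IS

  SameMinDFAState⇒∈ℒ-⇔ : ∀ {e w w′} → SameMinDFAState e w w′ → (w ∈ℒ e) ⇔ (w′ ∈ℒ e)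
  SameMinDFAState⇒∈ℒ-⇔ {e} {w} {w′} w≈w′ =
    subst₂ (λ u u′ → (u ∈ℒ e) ⇔ (u′ ∈ℒ e)) (++-identityʳ w) (++-identityʳ w′) (w≈w′ [])

  module _ (R : Interval → Interval → Set) {E : Interval → Interval → Set}
           {P : Interval → Set} (E⇒P-⇔ : ∀ {I′ J′} → E I′ J′ → P I′ ⇔ P J′) where

    BackForth⇒∀-⇔ : ∀ {I J} → BackForth R E I J
                  → (∀ I′ → R I I′ → P I′) ⇔ (∀ J′ → R J J′ → P J′)
    BackForth⇒∀-⇔ (forth , back) = mk⇔
      (λ h J′ JRJ′ → let I′ , IRI′ , I′EJ′ = back J′ JRJ′ in to (E⇒P-⇔ I′EJ′) (h I′ IRI′))
      (λ h I′ IRI′ → let J′ , JRJ′ , I′EJ′ = forth I′ IRI′ in from (E⇒P-⇔ I′EJ′) (h J′ JRJ′))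

    BackForth⇒∃-⇔ : ∀ {I J} → BackForth R E I J
                  → (∃[ I′ ] (R I I′ × P I′)) ⇔ (∃[ J′ ] (R J J′ × P J′))
    BackForth⇒∃-⇔ (forth , back) = mk⇔
      (λ (I′ , IRI′ , h) → let J′ , JRJ′ , I′EJ′ = forth I′ IRI′ in J′ , JRJ′ , to (E⇒P-⇔ I′EJ′) h)
      (λ (J′ , JRJ′ , h) → let I′ , IRI′ , I′EJ′ = back J′ JRJ′ in I′ , IRI′ , from (E⇒P-⇔ I′EJ′) h)

  mutual
    MCTEq⇒⊨-⇔ : ∀ φ {I J} → MCTEq φ I J → (I ⊨ φ) ⇔ (J ⊨ φ)
    MCTEq⇒⊨-⇔ φ (root , children) = ⊨-cong φ root children

    ⊨-cong : ∀ φ {I J} → RootEq I J → ChildrenEq φ I J → (I ⊨ φ) ⇔ (J ⊨ φ)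
    ⊨-cong pi {I} (_ , _ , pi≡ , _) _ = subst (λ b → (pi? I ≡ true) ⇔ (b ≡ true)) pi≡ ⇔.refl
    ⊨-cong (var p) (_ , _ , _ , nerode) _ = SameMinDFAState⇒∈ℒ-⇔ (nerode p)
    ⊨-cong (¬ᶠ φ) root children = ¬-cong-⇔ (⊨-cong φ root children)
    ⊨-cong (φ ∧ᶠ ψ) root (cφ , cψ) = ⊨-cong φ root cφ ×-⇔ ⊨-cong ψ root cψ
    -- I and J cannot be inferred from the unfolded relations, hence passed explicitly.
    ⊨-cong (K i ψ) {I} {J} _ children =
      BackForth⇒∀-⇔ (λ X Y → X ≈[ i ] Y) (MCTEq⇒⊨-⇔ ψ) {I} {J} children
    ⊨-cong (C Γ ψ) {I} {J} _ children =
      BackForth⇒∀-⇔ (λ X Y → X ≈C[ Γ ] Y) (MCTEq⇒⊨-⇔ ψ) {I} {J} children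
    ⊨-cong (⟨A⟩ ψ) {I} {J} _ children =
      BackForth⇒∃-⇔ R-A (MCTEq⇒⊨-⇔ ψ) {I} {J} children
    ⊨-cong (⟨B̄⟩ ψ) {I} {J} _ children =
      BackForth⇒∃-⇔ R-B̄ (MCTEq⇒⊨-⇔ ψ) {I} {J} children
    ⊨-cong (⟨N⟩ ψ) {I} {J} _ children =
      BackForth⇒∃-⇔ R-N (MCTEq⇒⊨-⇔ ψ) {I} {J} children

lemma3 : (IS : ISRL) (φ : Formula (ISRL.m IS) (ISRL.nV IS))
         (I J : Model.Interval IS)
         → Model.MCTEq IS φ I J
         → (Model._⊨_ IS I φ) ⇔ (Model._⊨_ IS J φ)
lemma3 IS φ I J = MCTEq⇒⊨-⇔ IS φ
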